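{- Let $\sigma$ be a binary string, let $I=[s,t]$ be a finite interval of integers with $s\ge|\sigma|$, and let $(a_i)_{i\in I}$ be integers such that $\sum_{i\in I}a_i2^{ -i}\ge 2^{ -|\sigma|+1}$. Then there exist a subset $J\subseteq I$ and a finite set $S$ of binary strings such that (i) $[S]=[\sigma]$; (ii) $|\tau|\in J$ for every $\tau\in S$; (iii) for every $j\in J$, $|S\cap\{0,1\}^{\le j}|\le a_j$. Moreover, $J$ and $S$ can be computed effectively from $\sigma$, $I$ and $(a_i)_{i\in I}$.
   Context: For a string $\sigma$, $[\sigma]$ is the set of infinite binary sequences having $\sigma$ as a prefix; for a set $S$ of strings, $[S]=\bigcup_{\tau\in S}[\tau]$. $\{0,1\}^{\le j}$ is the set of binary strings of length at most $j$. -}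

module Defs where

open import Data.Bool using (Bool)
open import Data.Nat as ℕ using (ℕ; _+_; _∸_; _^_; _≤?_)
open import Data.Nat.Properties using (m^n≢0)
open import Data.Integer as ℤ using (ℤ)
open import Data.Rational as ℚ using (ℚ; 0ℚ)
open import Data.List using (List; []; _∷_; map; foldr; upTo; length; filter)
open import Data.List.Relation.Unary.Any using (Any)
open import Relation.Binary.PropositionalEquality using (_≡_)

BinStr : Set
BinStr = List Bool

Seq : Set
Seq = ℕ → Bool

prefixOf : ℕ → Seq → BinStr
prefixOf ℕ.zero    X = []
prefixOf (ℕ.suc n) X = X 0 ∷ prefixOf n (λ i → X (ℕ.suc i))

_∈[_] : Seq → BinStr → Set
X ∈[ σ ] = prefixOf (length σ) X ≡ σ

_∈[_]ˢ : Seq → List BinStr → Set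
X ∈[ S ]ˢ = Any (λ τ → X ∈[ τ ]) S

record CylEq (S : List BinStr) (σ : BinStr) : Set where
  field
    to   : ∀ X → X ∈[ S ]ˢ → X ∈[ σ ]
    from : ∀ X → X ∈[ σ ] → X ∈[ S ]ˢ

-- The integer interval [s,t] = {s, s+1, ..., t} (empty if t < s).
interval : ℕ → ℕ → List ℕ
interval s t = map (λ k → s + k) (upTo (ℕ.suc t ∸ s))

_·2^-_ : ℤ → ℕ → ℚ
z ·2^- i = ℚ._/_ z (2 ^ i) {{m^n≢0 2 i}}

weightedSum : ℕ → ℕ → (ℕ → ℤ) → ℚ
weightedSum s t a = foldr (λ i acc → (a i ·2^- i) ℚ.+ acc) 0ℚ (interval s t)

-- |S ∩ {0,1}^{≤ j}| (for a duplicate-free list S)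
countUpTo : ℕ → List BinStr → ℕ
countUpTo j S = length (filter (λ τ → length τ ≤? j) S)

module Submission where

-- Let c_j be the running maximum of the positive parts of a_s, …, a_j.  Choose a
-- multiset G of lengths greedily, adding c_j − c_{j−1} copies of j at each level j, so
-- that G has exactly c_j elements ≤ j, and c_j = a_j whenever j occurs in G.  Since
--   ∑ a_i 2^{-i} ≤ ∑_j c_j 2^{-j} = ∑_{ℓ∈G} ∑_{j≥ℓ} 2^{-j} ≤ 2 ∑_{ℓ∈G} 2^{-ℓ},
-- the hypothesis makes the Kraft sum of G at least 2^{-|σ|}.  Kraft's construction then
-- carves a complete binary tree below σ whose leaf depths, read from left to right, form
-- an initial segment of the sorted list G; its leaves are the strings of S.

open import Defs
open import Data.Nat using (ℕ; _≤_)
open import Data.Integer using (+_) renaming (_≤_ to _≤ℤ_)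
open import Data.Integer using (ℤ)
open import Data.Rational using () renaming (_≤_ to _≤ℚ_)
open import Data.List using (List; length)
open import Data.List.Membership.Propositional using (_∈_)
open import Data.List.Relation.Unary.All using (All)
open import Data.List.Relation.Unary.Unique.Propositional using (Unique)
open import Data.Product using (Σ; _×_)

open import Data.Bool using (false; true)
open import Data.Empty using (⊥; ⊥-elim)
open import Data.Integer.Tactic.RingSolver using (solve-∀)
open import Data.List using ([]; _∷_; _++_; foldr; map; applyUpTo; replicate; filter)
open import Data.List.Membership.Propositional.Properties using (∈-++⁻; ∈-++⁺ˡ; ∈-map⁺; ∈-map⁻)
open import Data.List.Relation.Unary.All using (_∷_)
open import Data.List.Relation.Unary.Any using (here; there)
open import Data.Nat using (zero; suc; _+_; _*_; _^_; _∸_; NonZero)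
open import Data.Nat.Properties using (m^n≢0; m*n≢0; ^-distribˡ-+-*)
open import Data.Nat.Tactic.RingSolver using () renaming (solve-∀ to ℕ-solve-∀)
open import Data.Product using (_,_; proj₁; proj₂)
open import Data.Rational.Unnormalised using (ℚᵘ; mkℚᵘ; *≡*; *≤*; _/_; _≃_)
open import Data.Sum using (inj₁; inj₂)
open import Function using (_∘_)
open import Relation.Binary.PropositionalEquality hiding (J)
open import Relation.Nullary using (yes; no)

import Data.Integer as ℤ
import Data.Integer.Properties as ℤ
import Data.List.Properties as List
import Data.List.Relation.Unary.All as All
import Data.List.Relation.Unary.All.Properties as All
import Data.List.Relation.Unary.AllPairs as AllPairs
import Data.List.Relation.Unary.Any as Any
import Data.List.Relation.Unary.Any.Properties as Any
import Data.List.Relation.Unary.Unique.Propositional.Properties as Unique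
import Data.Nat as ℕ
import Data.Nat.Properties as ℕ
import Data.Rational as ℚ
import Data.Rational.Properties as ℚ
import Data.Rational.Unnormalised as ℚᵘ
import Data.Rational.Unnormalised.Properties as ℚᵘ

-- Dyadic sums

range : ℕ → ℕ → List ℕ
range j zero    = []
range j (suc m) = j ∷ range (suc j) m

map-applyUpTo≡range : ∀ (g f : ℕ → ℕ) j m → (∀ k → g (f k) ≡ j + k) →
                      map g (applyUpTo f m) ≡ range j m
map-applyUpTo≡range g f j zero    gf≗ = refl
map-applyUpTo≡range g f j (suc m) gf≗ =
  cong₂ _∷_ (trans (gf≗ 0) (ℕ.+-identityʳ j))
            (map-applyUpTo≡range g (f ∘ suc) (suc j) m (λ k → trans (gf≗ (suc k)) (ℕ.+-suc j k)))

interval≡range : ∀ s t → interval s t ≡ range s (suc t ∸ s)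
interval≡range s t = map-applyUpTo≡range (λ k → s + k) (λ k → k) s (suc t ∸ s) (λ _ → refl)

sumOver : (ℕ → ℤ) → List ℕ → ℚ.ℚ
sumOver a = foldr (λ i acc → (a i ·2^- i) ℚ.+ acc) ℚ.0ℚ

-- 2^{j+m} · ∑_{i ∈ range j m} a_i 2^{-i}
scaledSum : (ℕ → ℤ) → ℕ → ℕ → ℤ
scaledSum a j zero    = + 0
scaledSum a j (suc m) = a j ℤ.* + 2 ^ suc m ℤ.+ scaledSum a (suc j) m

_/2^_ : ℤ → ℕ → ℚᵘ
z /2^ n = (z / 2 ^ n) {{m^n≢0 2 n}}

toℚᵘ-/ : ∀ z n .{{_ : NonZero n}} → ℚ.toℚᵘ (z ℚ./ n) ≃ z / n
toℚᵘ-/ z (suc n) = ℚ.toℚᵘ-fromℚᵘ (mkℚᵘ z n)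

/-+-/-rescale : ∀ z w p q .{{_ : NonZero p}} .{{_ : NonZero q}} .{{_ : NonZero (p * q)}} →
                (z / p) ℚᵘ.+ (w / (p * q)) ≃ (z ℤ.* + q ℤ.+ w) / (p * q)
/-+-/-rescale z w (suc p) (suc q) = *≡* (identity z w (+ suc p) (+ suc q))
  where
  identity : ∀ z w p q → (z ℤ.* (p ℤ.* q) ℤ.+ w ℤ.* p) ℤ.* (p ℤ.* q) ≡ (z ℤ.* q ℤ.+ w) ℤ.* (p ℤ.* (p ℤ.* q))
  identity = solve-∀

/2^-+-/2^ : ∀ z w j k → (z /2^ j) ℚᵘ.+ (w /2^ (j + k)) ≃ (z ℤ.* + 2 ^ k ℤ.+ w) /2^ (j + k)
/2^-+-/2^ z w j k = begin
  (z /2^ j) ℚᵘ.+ (w /2^ (j + k))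
    ≡⟨ cong ((z /2^ j) ℚᵘ.+_) (ℚᵘ./-cong {{_}} {{2^j*2^k≢0}} refl 2^[j+k]≡2^j*2^k) ⟩
  (z /2^ j) ℚᵘ.+ (w / (2 ^ j * 2 ^ k)) {{2^j*2^k≢0}}
    ≈⟨ /-+-/-rescale z w (2 ^ j) (2 ^ k) {{m^n≢0 2 j}} {{m^n≢0 2 k}} {{2^j*2^k≢0}} ⟩
  ((z ℤ.* + 2 ^ k ℤ.+ w) / (2 ^ j * 2 ^ k)) {{2^j*2^k≢0}}
    ≡⟨ ℚᵘ./-cong {{2^j*2^k≢0}} {{m^n≢0 2 (j + k)}} refl (sym 2^[j+k]≡2^j*2^k) ⟩
  (z ℤ.* + 2 ^ k ℤ.+ w) /2^ (j + k) ∎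
  where
  open ℚᵘ.≃-Reasoning
  2^[j+k]≡2^j*2^k : 2 ^ (j + k) ≡ 2 ^ j * 2 ^ k
  2^[j+k]≡2^j*2^k = ^-distribˡ-+-* 2 j k
  2^j*2^k≢0 : NonZero (2 ^ j * 2 ^ k)
  2^j*2^k≢0 = m*n≢0 (2 ^ j) (2 ^ k) {{m^n≢0 2 j}} {{m^n≢0 2 k}}

toℚᵘ-sumOver-range : ∀ a j m → ℚ.toℚᵘ (sumOver a (range j m)) ≃ scaledSum a j m /2^ (j + m)
toℚᵘ-sumOver-range a j zero =
  *≡* (sym (trans (ℤ.*-identityʳ _) (ℚᵘ.↥[n/d]≡n (+ 0) (2 ^ (j + 0)) {{m^n≢0 2 (j + 0)}})))
toℚᵘ-sumOver-range a j (suc m) = begin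
  ℚ.toℚᵘ ((a j ·2^- j) ℚ.+ sumOver a (range (suc j) m))
    ≈⟨ ℚ.toℚᵘ-homo-+ (a j ·2^- j) _ ⟩
  ℚ.toℚᵘ (a j ·2^- j) ℚᵘ.+ ℚ.toℚᵘ (sumOver a (range (suc j) m))
    ≈⟨ ℚᵘ.+-cong (toℚᵘ-/ (a j) (2 ^ j) {{m^n≢0 2 j}}) (toℚᵘ-sumOver-range a (suc j) m) ⟩
  (a j /2^ j) ℚᵘ.+ (scaledSum a (suc j) m /2^ (suc j + m))
    ≡⟨ cong (λ n → (a j /2^ j) ℚᵘ.+ (scaledSum a (suc j) m /2^ n)) (sym (ℕ.+-suc j m)) ⟩
  (a j /2^ j) ℚᵘ.+ (scaledSum a (suc j) m /2^ (j + suc m))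
    ≈⟨ /2^-+-/2^ (a j) _ j (suc m) ⟩
  scaledSum a j (suc m) /2^ (j + suc m) ∎
  where open ℚᵘ.≃-Reasoning

/-≤-/⇒*-≤ : ∀ x y p q .{{_ : NonZero p}} .{{_ : NonZero q}} → (x / p) ℚᵘ.≤ (y / q) → x ℤ.* + q ℤ.≤ y ℤ.* + p
/-≤-/⇒*-≤ x y (suc p) (suc q) (*≤* x*q≤y*p) = x*q≤y*p

2/2^L≤sumOver⇒2*2^D≤scaledSum*2^L : ∀ a L j m → ((+ 2) ·2^- L) ≤ℚ sumOver a (range j m) →
                                   + 2 ℤ.* + 2 ^ (j + m) ℤ.≤ scaledSum a j m ℤ.* + 2 ^ L
2/2^L≤sumOver⇒2*2^D≤scaledSum*2^L a L j m hyp =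
  /-≤-/⇒*-≤ (+ 2) (scaledSum a j m) (2 ^ L) (2 ^ (j + m)) {{m^n≢0 2 L}} {{m^n≢0 2 (j + m)}}
    (ℚᵘ.≤-respʳ-≃ (toℚᵘ-sumOver-range a j m)
      (ℚᵘ.≤-respˡ-≃ (toℚᵘ-/ (+ 2) (2 ^ L) {{m^n≢0 2 L}}) (ℚ.toℚᵘ-mono-≤ hyp)))

-- The greedy choice of lengths

fresh : ℤ → ℕ → ℕ
fresh (+ n)      N = n ∸ N
fresh ℤ.-[1+ n ] N = 0

≤-+-fresh : ∀ z N → z ℤ.≤ + (N + fresh z N)
≤-+-fresh (+ n)      N = ℤ.+≤+ (ℕ.m≤n+m∸n n N)
≤-+-fresh ℤ.-[1+ n ] N = ℤ.-≤+

+-fresh-≤ : ∀ z N → 0 ℕ.< fresh z N → + (N + fresh z N) ℤ.≤ z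
+-fresh-≤ (+ n)      N 0<n∸N =
  ℤ.+≤+ (ℕ.≤-reflexive (ℕ.m+[n∸m]≡n (ℕ.<⇒≤ (ℕ.m∸n≢0⇒n<m {n} {N} (ℕ.n>0⇒n≢0 0<n∸N)))))
+-fresh-≤ ℤ.-[1+ n ] N ()

-- N is the number of lengths chosen so far, all of them smaller than j.
greedy : (ℕ → ℤ) → ℕ → ℕ → ℕ → List ℕ
greedy a N j zero    = []
greedy a N j (suc m) = replicate (fresh (a j) N) j ++ greedy a (N + fresh (a j) N) (suc j) m

-- 2^D times the Kraft sum ∑_{e ∈ es} 2^{-e}, for lengths e ≤ D.
weight : ℕ → List ℕ → ℕ
weight D []       = 0
weight D (e ∷ es) = 2 ^ (D ∸ e) + weight D es

weight-++ : ∀ D xs ys → weight D (xs ++ ys) ≡ weight D xs + weight D ys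
weight-++ D []       ys = refl
weight-++ D (x ∷ xs) ys =
  trans (cong (λ w → 2 ^ (D ∸ x) + w) (weight-++ D xs ys)) (sym (ℕ.+-assoc (2 ^ (D ∸ x)) _ _))

weight-replicate : ∀ D k j → weight D (replicate k j) ≡ k * 2 ^ (D ∸ j)
weight-replicate D zero    j = refl
weight-replicate D (suc k) j = cong (λ w → 2 ^ (D ∸ j) + w) (weight-replicate D k j)

scaledSum≤greedyWeight : ∀ a N {D} j m → j + m ≡ D →
                         scaledSum a j m ℤ.≤ + (N * 2 ^ suc m + 2 * weight D (greedy a N j m))
scaledSum≤greedyWeight a N j zero    _    = ℤ.+≤+ ℕ.z≤n
scaledSum≤greedyWeight a N j (suc m) refl = begin
  a j ℤ.* + P ℤ.+ scaledSum a (suc j) m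
    ≤⟨ ℤ.+-mono-≤ head≤ (scaledSum≤greedyWeight a N′ (suc j) m (sym (ℕ.+-suc j m))) ⟩
  + (N′ * P) ℤ.+ + (N′ * P + 2 * W)
    ≡⟨ ℤ.pos-+ (N′ * P) _ ⟨
  + (N′ * P + (N′ * P + 2 * W))
    ≡⟨ cong +_ (identity N k P W) ⟩
  + (N * (2 * P) + 2 * (k * P + W))
    ≡⟨ cong (λ w → + (N * (2 * P) + 2 * w)) weight≡ ⟨
  + (N * 2 ^ suc (suc m) + 2 * weight (j + suc m) (greedy a N j (suc m))) ∎
  where
  open ℤ.≤-Reasoning
  k N′ P W : ℕ
  k  = fresh (a j) N
  N′ = N + k
  P  = 2 ^ suc m
  W  = weight (j + suc m) (greedy a N′ (suc j) m)
  head≤ : a j ℤ.* + P ℤ.≤ + (N′ * P)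
  head≤ = subst (a j ℤ.* + P ℤ.≤_) (sym (ℤ.pos-* N′ P)) (ℤ.*-monoʳ-≤-nonNeg (+ P) (≤-+-fresh (a j) N))
  identity : ∀ N k P W → (N + k) * P + ((N + k) * P + 2 * W) ≡ N * (2 * P) + 2 * (k * P + W)
  identity = ℕ-solve-∀
  weight≡ : weight (j + suc m) (greedy a N j (suc m)) ≡ k * P + W
  weight≡ = trans (weight-++ (j + suc m) (replicate k j) _)
                  (cong (_+ W) (trans (weight-replicate (j + suc m) k j)
                                      (cong (λ e → k * 2 ^ e) (ℕ.m+n∸m≡n j (suc m)))))

2*2^D≤2*W*2^L⇒2^[D∸L]≤W : ∀ {L D} W → L ≤ D → 2 * 2 ^ D ≤ 2 * W * 2 ^ L → 2 ^ (D ∸ L) ≤ W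
2*2^D≤2*W*2^L⇒2^[D∸L]≤W {L} {D} W L≤D 2*2^D≤ =
  ℕ.*-cancelʳ-≤ (2 ^ (D ∸ L)) W (2 ^ L) {{m^n≢0 2 L}} (ℕ.*-cancelˡ-≤ 2 (begin
    2 * (2 ^ (D ∸ L) * 2 ^ L)  ≡⟨ cong (2 *_) (^-distribˡ-+-* 2 (D ∸ L) L) ⟨
    2 * 2 ^ (D ∸ L + L)        ≡⟨ cong (λ n → 2 * 2 ^ n) (ℕ.m∸n+n≡m L≤D) ⟩
    2 * 2 ^ D                  ≤⟨ 2*2^D≤ ⟩
    2 * W * 2 ^ L              ≡⟨ ℕ.*-assoc 2 W (2 ^ L) ⟩
    2 * (W * 2 ^ L)            ∎))
  where open ℕ.≤-Reasoning

greedy-budget : ∀ a L j m → L ≤ j + m → ((+ 2) ·2^- L) ≤ℚ sumOver a (range j m) →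
                2 ^ (j + m ∸ L) ≤ weight (j + m) (greedy a 0 j m)
greedy-budget a L j m L≤D hyp = 2*2^D≤2*W*2^L⇒2^[D∸L]≤W W L≤D (ℤ.drop‿+≤+ (begin
  + (2 * 2 ^ (j + m))          ≡⟨ ℤ.pos-* 2 (2 ^ (j + m)) ⟩
  + 2 ℤ.* + 2 ^ (j + m)        ≤⟨ 2/2^L≤sumOver⇒2*2^D≤scaledSum*2^L a L j m hyp ⟩
  scaledSum a j m ℤ.* + 2 ^ L  ≤⟨ ℤ.*-monoʳ-≤-nonNeg (+ 2 ^ L) (scaledSum≤greedyWeight a 0 j m refl) ⟩
  + (2 * W) ℤ.* + 2 ^ L        ≡⟨ ℤ.pos-* (2 * W) (2 ^ L) ⟨
  + (2 * W * 2 ^ L)            ∎))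
  where
  open ℤ.≤-Reasoning
  W : ℕ
  W = weight (j + m) (greedy a 0 j m)

∈-range⁻ : ∀ {e} j m → e ∈ range j m → j ≤ e × e ℕ.< j + m
∈-range⁻     j (suc m) (here refl) = ℕ.≤-refl , ℕ.m<m+n j ℕ.z<s
∈-range⁻ {e} j (suc m) (there e∈) with ∈-range⁻ (suc j) m e∈
... | j<e , e<1+j+m = ℕ.<⇒≤ j<e , subst (e ℕ.<_) (sym (ℕ.+-suc j m)) e<1+j+m

∈-replicate⁻ : ∀ {A : Set} {x y : A} n → x ∈ replicate n y → x ≡ y × 0 ℕ.< n
∈-replicate⁻ (suc n) (here x≡y) = x≡y , ℕ.z<s
∈-replicate⁻ (suc n) (there x∈) = proj₁ (∈-replicate⁻ n x∈) , ℕ.z<s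

greedy⊆range : ∀ a N j m {e} → e ∈ greedy a N j m → e ∈ range j m
greedy⊆range a N j (suc m) e∈ with ∈-++⁻ (replicate (fresh (a j) N) j) e∈
... | inj₁ e∈rep  = here (proj₁ (∈-replicate⁻ (fresh (a j) N) e∈rep))
... | inj₂ e∈rest = there (greedy⊆range a (N + fresh (a j) N) (suc j) m e∈rest)

greedy-above : ∀ a N j m → All (j ℕ.<_) (greedy a N (suc j) m)
greedy-above a N j m = All.tabulate (λ e∈ → proj₁ (∈-range⁻ (suc j) m (greedy⊆range a N (suc j) m e∈)))

countAtMost : ℕ → List ℕ → ℕ
countAtMost e xs = length (filter (ℕ._≤? e) xs)

countAtMost-++ : ∀ e xs ys → countAtMost e (xs ++ ys) ≡ countAtMost e xs + countAtMost e ys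
countAtMost-++ e xs ys =
  trans (cong length (List.filter-++ (ℕ._≤? e) xs ys)) (List.length-++ (filter (ℕ._≤? e) xs))

countAtMost-replicate-++ : ∀ {e j} k xs → j ≤ e → countAtMost e (replicate k j ++ xs) ≡ k + countAtMost e xs
countAtMost-replicate-++ {e} k xs j≤e = trans (countAtMost-++ e (replicate k _) xs)
  (cong (_+ countAtMost e xs)
        (trans (cong length (List.filter-all (ℕ._≤? e) (All.replicate⁺ k j≤e))) (List.length-replicate k)))

countAtMost-above : ∀ {e xs} → All (e ℕ.<_) xs → countAtMost e xs ≡ 0
countAtMost-above {e} e<xs = cong length (List.filter-none (ℕ._≤? e) (All.map ℕ.<⇒≱ e<xs))

greedy-count : ∀ a N j m {e} → e ∈ greedy a N j m → + (N + countAtMost e (greedy a N j m)) ℤ.≤ a e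
greedy-count a N j (suc m) e∈ with ∈-++⁻ (replicate (fresh (a j) N) j) e∈
... | inj₁ e∈rep with ∈-replicate⁻ (fresh (a j) N) e∈rep
...   | refl , 0<k = subst (λ c → + (N + c) ℤ.≤ a j) (sym count≡k) (+-fresh-≤ (a j) N 0<k)
  where
  k : ℕ
  k = fresh (a j) N
  count≡k : countAtMost j (greedy a N j (suc m)) ≡ k
  count≡k = trans (countAtMost-replicate-++ k _ ℕ.≤-refl)
                  (trans (cong (λ c → k + c) (countAtMost-above (greedy-above a (N + k) j m))) (ℕ.+-identityʳ k))
greedy-count a N j (suc m) {e} e∈ | inj₂ e∈rest =
  subst (λ c → + c ℤ.≤ a e) (trans (ℕ.+-assoc N k _) (cong (λ c → N + c) (sym (countAtMost-replicate-++ k _ j≤e))))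
        (greedy-count a (N + k) (suc j) m e∈rest)
  where
  k : ℕ
  k = fresh (a j) N
  j≤e : j ≤ e
  j≤e = ℕ.<⇒≤ (proj₁ (∈-range⁻ (suc j) m (greedy⊆range a (N + k) (suc j) m e∈rest)))

data SortedFrom : ℕ → List ℕ → Set where
  []  : ∀ {d} → SortedFrom d []
  _∷_ : ∀ {d e es} → d ≤ e → SortedFrom e es → SortedFrom d (e ∷ es)

SortedFrom-weaken : ∀ {d′ d es} → d′ ≤ d → SortedFrom d es → SortedFrom d′ es
SortedFrom-weaken d′≤d []             = []
SortedFrom-weaken d′≤d (d≤e ∷ sorted) = ℕ.≤-trans d′≤d d≤e ∷ sorted

SortedFrom-++⁻ʳ : ∀ {d} xs {ys} → SortedFrom d (xs ++ ys) → SortedFrom d ys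
SortedFrom-++⁻ʳ []       sorted         = sorted
SortedFrom-++⁻ʳ (x ∷ xs) (d≤x ∷ sorted) = SortedFrom-weaken d≤x (SortedFrom-++⁻ʳ xs sorted)

SortedFrom-replicate-++ : ∀ {d j ys} k → d ≤ j → SortedFrom j ys → SortedFrom d (replicate k j ++ ys)
SortedFrom-replicate-++ zero    d≤j sorted = SortedFrom-weaken d≤j sorted
SortedFrom-replicate-++ (suc k) d≤j sorted = d≤j ∷ SortedFrom-replicate-++ k ℕ.≤-refl sorted

greedy-sorted : ∀ a N j m → SortedFrom j (greedy a N j m)
greedy-sorted a N j zero    = []
greedy-sorted a N j (suc m) =
  SortedFrom-replicate-++ (fresh (a j) N) ℕ.≤-refl (SortedFrom-weaken (ℕ.n≤1+n j) (greedy-sorted a _ (suc j) m))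

-- Kraft's construction

data Tree : Set where
  leaf : Tree
  node : Tree → Tree → Tree

depths : ℕ → Tree → List ℕ
depths d leaf       = d ∷ []
depths d (node l r) = depths (suc d) l ++ depths (suc d) r

record KraftTree (D d : ℕ) (es : List ℕ) : Set where
  field
    tree  : Tree
    rest  : List ℕ
    split : es ≡ depths d tree ++ rest
    full  : weight D (depths d tree) ≡ 2 ^ (D ∸ d)

open KraftTree

weight-split : ∀ {D d es} (K : KraftTree D d es) → weight D es ≡ 2 ^ (D ∸ d) + weight D (rest K)
weight-split {D} K =
  trans (cong (weight D) (split K)) (trans (weight-++ D (depths _ (tree K)) (rest K)) (cong (_+ weight D (rest K)) (full K)))

rest-sorted : ∀ {D d es} (K : KraftTree D d es) → SortedFrom d es → SortedFrom d (rest K)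
rest-sorted K sorted = SortedFrom-++⁻ʳ (depths _ (tree K)) (subst (SortedFrom _) (split K) sorted)

rest-bounded : ∀ {D d es} (K : KraftTree D d es) → All (ℕ._< D) es → All (ℕ._< D) (rest K)
rest-bounded K bounded = All.++⁻ʳ (depths _ (tree K)) (subst (All _) (split K) bounded)

2^[D∸d]≡h+h : ∀ d n → let h = 2 ^ (d + suc n ∸ suc d) in 2 ^ (d + suc n ∸ d) ≡ h + h
2^[D∸d]≡h+h d n = begin
  2 ^ (d + suc n ∸ d)  ≡⟨ cong (2 ^_) (ℕ.m+n∸m≡n d (suc n)) ⟩
  2 ^ n + (2 ^ n + 0)  ≡⟨ cong (λ x → 2 ^ n + x) (ℕ.+-identityʳ (2 ^ n)) ⟩
  2 ^ n + 2 ^ n        ≡⟨ cong₂ _+_ 2^n≡h 2^n≡h ⟩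
  h + h                ∎
  where
  open ≡-Reasoning
  h : ℕ
  h = 2 ^ (d + suc n ∸ suc d)
  2^n≡h : 2 ^ n ≡ h
  2^n≡h = cong (2 ^_) (sym (trans (cong (_∸ suc d) (ℕ.+-suc d n)) (ℕ.m+n∸m≡n d n)))

-- A leaf is placed when the next length equals the current depth; otherwise both subtrees
-- are carved in turn, each consuming half of the required budget.
kraftTree : ∀ {D} d n es → d + n ≡ D → SortedFrom d es → All (ℕ._< D) es → 2 ^ (D ∸ d) ≤ weight D es →
            KraftTree D d es
kraftTree {D} d n [] _ _ _ budget = ⊥-elim (ℕ.<⇒≱ (ℕ.m^n>0 2 (D ∸ d)) budget)
kraftTree d zero (e ∷ es) refl (d≤e ∷ _) (e<d+0 ∷ _) _ =
  ⊥-elim (ℕ.<⇒≱ (subst (e ℕ.<_) (ℕ.+-identityʳ d) e<d+0) d≤e)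
kraftTree d (suc n) (e ∷ es) refl (d≤e ∷ sorted) bounded budget with e ℕ.≟ d
... | yes refl = record { tree = leaf ; rest = es ; split = refl ; full = ℕ.+-identityʳ _ }
... | no e≢d = record
  { tree  = node (tree L) (tree R)
  ; rest  = rest R
  ; split = trans (split L) (trans (cong (depths (suc d) (tree L) ++_) (split R))
                                   (sym (List.++-assoc (depths (suc d) (tree L)) _ (rest R))))
  ; full  = trans (weight-++ D (depths (suc d) (tree L)) _)
                  (trans (cong₂ _+_ (full L) (full R)) (sym (2^[D∸d]≡h+h d n)))
  }
  where
  D h : ℕ
  D = d + suc n
  h = 2 ^ (D ∸ suc d)
  1+d+n≡D : suc d + n ≡ D
  1+d+n≡D = sym (ℕ.+-suc d n)
  sorted′ : SortedFrom (suc d) (e ∷ es)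
  sorted′ = ℕ.≤∧≢⇒< d≤e (e≢d ∘ sym) ∷ sorted
  h+h≤budget : h + h ≤ weight D (e ∷ es)
  h+h≤budget = subst (_≤ weight D (e ∷ es)) (2^[D∸d]≡h+h d n) budget
  L : KraftTree D (suc d) (e ∷ es)
  L = kraftTree (suc d) n (e ∷ es) 1+d+n≡D sorted′ bounded (ℕ.≤-trans (ℕ.m≤m+n h h) h+h≤budget)
  R : KraftTree D (suc d) (rest L)
  R = kraftTree (suc d) n (rest L) 1+d+n≡D (rest-sorted L sorted′) (rest-bounded L bounded)
        (ℕ.+-cancelˡ-≤ h h _ (subst (h + h ≤_) (weight-split L) h+h≤budget))

greedy-kraftTree : ∀ a L j m → L ≤ j → ((+ 2) ·2^- L) ≤ℚ sumOver a (range j m) →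
                   KraftTree (j + m) L (greedy a 0 j m)
greedy-kraftTree a L j m L≤j hyp =
  kraftTree L (j + m ∸ L) (greedy a 0 j m) (ℕ.m+[n∸m]≡n L≤D)
    (SortedFrom-weaken L≤j (greedy-sorted a 0 j m))
    (All.tabulate (λ e∈ → proj₂ (∈-range⁻ j m (greedy⊆range a 0 j m e∈))))
    (greedy-budget a L j m L≤D hyp)
  where
  L≤D : L ≤ j + m
  L≤D = ℕ.≤-trans L≤j (ℕ.m≤m+n j m)

-- Codewords and cylinders

leaves : Tree → List BinStr
leaves leaf       = [] ∷ []
leaves (node l r) = map (false ∷_) (leaves l) ++ map (true ∷_) (leaves r)

codewords : BinStr → Tree → List BinStr
codewords σ T = map (σ ++_) (leaves T)

map-length-leaves : ∀ d T → map (λ ρ → d + length ρ) (leaves T) ≡ depths d T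
map-length-leaves d leaf       = cong (_∷ []) (ℕ.+-identityʳ d)
map-length-leaves d (node l r) = begin
  map f (map (false ∷_) (leaves l) ++ map (true ∷_) (leaves r))
    ≡⟨ List.map-++ f (map (false ∷_) (leaves l)) _ ⟩
  map f (map (false ∷_) (leaves l)) ++ map f (map (true ∷_) (leaves r))
    ≡⟨ cong₂ _++_ (below false l) (below true r) ⟩
  depths (suc d) l ++ depths (suc d) r ∎
  where
  open ≡-Reasoning
  f : BinStr → ℕ
  f ρ = d + length ρ
  below : ∀ b T → map f (map (b ∷_) (leaves T)) ≡ depths (suc d) T
  below b T = trans (sym (List.map-∘ (leaves T)))
                    (trans (List.map-cong (λ ρ → ℕ.+-suc d (length ρ)) (leaves T)) (map-length-leaves (suc d) T))

map-length-codewords : ∀ σ T → map length (codewords σ T) ≡ depths (length σ) T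
map-length-codewords σ T = trans (sym (List.map-∘ (leaves T)))
  (trans (List.map-cong (λ ρ → List.length-++ σ {ρ}) (leaves T)) (map-length-leaves (length σ) T))

leaves-unique : ∀ T → Unique (leaves T)
leaves-unique leaf       = All.[] AllPairs.∷ AllPairs.[]
leaves-unique (node l r) = Unique.++⁺ (Unique.map⁺ List.∷-injectiveʳ (leaves-unique l))
                                      (Unique.map⁺ List.∷-injectiveʳ (leaves-unique r)) disjoint
  where
  disjoint : ∀ {v} → v ∈ map (false ∷_) (leaves l) × v ∈ map (true ∷_) (leaves r) → ⊥
  disjoint (v∈l , v∈r) with ∈-map⁻ (false ∷_) v∈l | ∈-map⁻ (true ∷_) v∈r
  ... | _ , _ , refl | _ , _ , ()

codewords-unique : ∀ σ T → Unique (codewords σ T)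
codewords-unique σ T = Unique.map⁺ (List.++-cancelˡ σ _ _) (leaves-unique T)

shift : ℕ → Seq → Seq
shift k X i = X (k + i)

∈[++]⁻ : ∀ σ {ρ} X → X ∈[ σ ++ ρ ] → X ∈[ σ ] × shift (length σ) X ∈[ ρ ]
∈[++]⁻ []      X X∈ = refl , X∈
∈[++]⁻ (b ∷ σ) X X∈ with List.∷-injective X∈
... | X0≡b , X∈′ with ∈[++]⁻ σ (X ∘ suc) X∈′
...   | X∈σ , X∈ρ = cong₂ _∷_ X0≡b X∈σ , X∈ρ

∈[++]⁺ : ∀ σ {ρ} X → X ∈[ σ ] → shift (length σ) X ∈[ ρ ] → X ∈[ σ ++ ρ ]
∈[++]⁺ []      X _   X∈ρ = X∈ρ
∈[++]⁺ (b ∷ σ) X X∈σ X∈ρ with List.∷-injective X∈σ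
... | X0≡b , X∈σ′ = cong₂ _∷_ X0≡b (∈[++]⁺ σ (X ∘ suc) X∈σ′ X∈ρ)

leaves-cover : ∀ T Y → Y ∈[ leaves T ]ˢ
leaves-cover leaf       Y = here refl
leaves-cover (node l r) Y with Y 0 in Y0≡
... | false = Any.++⁺ˡ (Any.map⁺ (Any.map (cong₂ _∷_ Y0≡) (leaves-cover l (Y ∘ suc))))
... | true  = Any.++⁺ʳ (map (false ∷_) (leaves l))
                       (Any.map⁺ (Any.map (cong₂ _∷_ Y0≡) (leaves-cover r (Y ∘ suc))))

codewords-cylinder : ∀ σ T → CylEq (codewords σ T) σ
codewords-cylinder σ T = record
  { to   = λ X X∈ → proj₁ (∈[++]⁻ σ X (proj₂ (Any.satisfied (Any.map⁻ X∈))))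
  ; from = λ X X∈σ → Any.map⁺ (Any.map (∈[++]⁺ σ X X∈σ) (leaves-cover T (shift (length σ) X)))
  }

countUpTo≡countAtMost : ∀ j S → countUpTo j S ≡ countAtMost j (map length S)
countUpTo≡countAtMost j []      = refl
countUpTo≡countAtMost j (τ ∷ S) with length τ ℕ.≤? j
... | yes |τ|≤j = begin
  length (filter (λ τ → length τ ℕ.≤? j) (τ ∷ S))
    ≡⟨ cong length (List.filter-accept (λ τ → length τ ℕ.≤? j) {τ} {S} |τ|≤j) ⟩
  suc (countUpTo j S)
    ≡⟨ cong suc (countUpTo≡countAtMost j S) ⟩
  suc (countAtMost j (map length S))
    ≡⟨ cong length (List.filter-accept (ℕ._≤? j) {length τ} {map length S} |τ|≤j) ⟨
  countAtMost j (map length (τ ∷ S)) ∎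
  where open ≡-Reasoning
... | no |τ|≰j = begin
  length (filter (λ τ → length τ ℕ.≤? j) (τ ∷ S))
    ≡⟨ cong length (List.filter-reject (λ τ → length τ ℕ.≤? j) {τ} {S} |τ|≰j) ⟩
  countUpTo j S
    ≡⟨ countUpTo≡countAtMost j S ⟩
  countAtMost j (map length S)
    ≡⟨ cong length (List.filter-reject (ℕ._≤? j) {length τ} {map length S} |τ|≰j) ⟨
  countAtMost j (map length (τ ∷ S)) ∎
  where open ≡-Reasoning

module _ (σ : BinStr) {D es} (K : KraftTree D (length σ) es) where

  lengths-codewords⊆ : ∀ {j} → j ∈ map length (codewords σ (tree K)) → j ∈ es
  lengths-codewords⊆ j∈ =
    subst (_ ∈_) (sym (split K)) (∈-++⁺ˡ (subst (_ ∈_) (map-length-codewords σ (tree K)) j∈))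

  countUpTo-codewords≤ : ∀ j → countUpTo j (codewords σ (tree K)) ≤ countAtMost j es
  countUpTo-codewords≤ j = begin
    countUpTo j (codewords σ T)                           ≡⟨ countUpTo≡countAtMost j (codewords σ T) ⟩
    countAtMost j (map length (codewords σ T))            ≡⟨ cong (countAtMost j) (map-length-codewords σ T) ⟩
    countAtMost j (depths _ T)                            ≤⟨ ℕ.m≤m+n _ _ ⟩
    countAtMost j (depths _ T) + countAtMost j (rest K)   ≡⟨ countAtMost-++ j (depths _ T) (rest K) ⟨
    countAtMost j (depths _ T ++ rest K)                  ≡⟨ cong (countAtMost j) (split K) ⟨
    countAtMost j es                                      ∎
    where
    open ℕ.≤-Reasoning
    T : Tree
    T = tree K

mainTheorem6 : (σ : BinStr) (s t : ℕ) (a : ℕ → ℤ) →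
    length σ ≤ s →
    ((+ 2) ·2^- length σ) ≤ℚ weightedSum s t a →
    Σ (List ℕ) λ J → Σ (List BinStr) λ S →
      All (λ j → j ∈ interval s t) J ×
      Unique S ×
      CylEq S σ ×
      All (λ τ → length τ ∈ J) S ×
      All (λ j → (+ countUpTo j S) ≤ℤ a j) J
mainTheorem6 σ s t a |σ|≤s hyp =
  J , S , All.tabulate J⊆interval , codewords-unique σ T , codewords-cylinder σ T ,
  All.tabulate (∈-map⁺ length) , All.tabulate counts≤a
  where
  m : ℕ
  m = suc t ∸ s
  K : KraftTree (s + m) (length σ) (greedy a 0 s m)
  K = greedy-kraftTree a (length σ) s m |σ|≤s (subst (λ is → _ ≤ℚ sumOver a is) (interval≡range s t) hyp)
  T : Tree
  T = tree K
  S : List BinStr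
  S = codewords σ T
  J : List ℕ
  J = map length S
  J⊆interval : ∀ {j} → j ∈ J → j ∈ interval s t
  J⊆interval j∈J = subst (_ ∈_) (sym (interval≡range s t)) (greedy⊆range a 0 s m (lengths-codewords⊆ σ K j∈J))
  counts≤a : ∀ {j} → j ∈ J → + countUpTo j S ≤ℤ a j
  counts≤a {j} j∈J = ℤ.≤-trans (ℤ.+≤+ (countUpTo-codewords≤ σ K j)) (greedy-count a 0 s m (lengths-codewords⊆ σ K j∈J))
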